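{- Let $\mu=(\mu_1,\dots,\mu_k)\vdash n$ and $a=(a_1,\dots,a_h)\vDash n$ with $\mu\unrhd\lambda(a)$, and assume $a_h\ge2$. For every $i\in R(\mu,a)$ with $i\le s(\mu^{(i)},\tilde a)$, we have $\rho(\mu^{(i)},\tilde a)\in\mathcal B(\mu,a)$.
   Context: A composition $a\vDash n$ is a sequence of positive integers summing to $n$; a partition $\mu\vdash n$ is a non-increasing composition, with $\mu_i=0$ beyond its parts and trailing zeros deleted. For compositions $a=(a_1,\dots,a_h)$, $b=(b_1,\dots,b_k)$ of $n$, $a\unrhd b$ means $k\ge h$ and $\sum_{i=1}^j a_i\ge\sum_{i=1}^jb_i$ for $j=1,\dots,h$. $\lambda(a)$ is the non-increasing rearrangement of $a$; $a'=(a_1,\dots,a_{h-1})$; $\tilde a=(a_1,\dots,a_{h-1},a_h-1)$ if $a_h\ge2$ and $\tilde a=(a_1,\dots,a_{h-1})$ if $a_h=1$. $\mu^{(i)}$ is $\mu$ with its $i$-th entry decreased by $1$. For a partition $\nu=(\nu_1,\dots,\nu_m)$ and composition $b$ with last part $b_{h(b)}$, $s(\nu,b)=\max\{i:1\le i\le m,\ \nu_i\ge b_{h(b)}\}$. $R(\mu,a)$ is the set of $i\in\{1,\dots,k\}$ with $\mu_i>\mu_{i+1}$ and $\mu^{(i)}\unrhd\lambda(\tilde a)$. For $\nu\vdash N$, $b\vDash N$ with $\nu\unrhd\lambda(b)$ and $s=s(\nu,b)$, $\rho(\nu,b)=(\rho_1,\dots,\rho_{m-1})$ with $\rho_i=\nu_i$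 ($i<s$), $\rho_s=\nu_s-(b_{h(b)}-\nu_{s+1})$, $\rho_i=\nu_{i+1}$ ($s<i\le m-1$). For $\rho=(\rho_1,\dots,\rho_h)\vdash m'$ and $\mu=(\mu_1,\dots,\mu_k)\vdash n$, $\rho\preceq\mu$ means $m'\le n$, $h\le k$, $\rho_i\le\mu_i$ for $i\le h$; $\mu/\rho$ is totally disconnected if $\rho_i\ge\mu_{i+1}$ for $1\le i\le h$. $\mathcal B(\mu,a)=\{\rho\vdash n-a_h:\rho\unrhd\lambda(a'),\ \rho\preceq\mu,\ \mu/\rho\text{ totally disconnected}\}$. -}

module Defs where

open import Data.Nat using (ℕ; zero; suc; _+_; _∸_; _≤_; _<_; _≥_; _>_; _≤ᵇ_; _⊔_)
open import Data.Bool using (if_then_else_)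
open import Data.List using (List; []; _∷_; _++_; [_]; length; take; drop; reverse)
open import Data.Nat.ListAction using (sum)
open import Relation.Binary.PropositionalEquality using (_≡_)
open import Data.Product using (_×_)
open import Data.List.Relation.Unary.All using (All)

-- 1-based entry lookup; entries beyond the list (and index 0) are 0.
at : List ℕ → ℕ → ℕ
at []       _             = 0
at (x ∷ xs) zero          = 0
at (x ∷ xs) (suc zero)    = x
at (x ∷ xs) (suc (suc i)) = at xs (suc i)

lastPart : List ℕ → ℕ
lastPart a = at a (length a)

IsComposition : ℕ → List ℕ → Set
IsComposition n a = All (λ x → 1 ≤ x) a × sum a ≡ n

data NonIncreasing : List ℕ → Set where
  ni-[]  : NonIncreasing []
  ni-[x] : ∀ {x} → NonIncreasing (x ∷ [])
  ni-∷   : ∀ {x y ys} → y ≤ x → NonIncreasing (y ∷ ys) → NonIncreasing (x ∷ y ∷ ys)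

IsPartition : ℕ → List ℕ → Set
IsPartition n μ = IsComposition n μ × NonIncreasing μ

_⊵_ : List ℕ → List ℕ → Set
a ⊵ b = (length a ≤ length b) ×
        (∀ j → 1 ≤ j → j ≤ length a → sum (take j b) ≤ sum (take j a))

insertDesc : ℕ → List ℕ → List ℕ
insertDesc x []       = x ∷ []
insertDesc x (y ∷ ys) = if y ≤ᵇ x then x ∷ y ∷ ys else y ∷ insertDesc x ys

sortDesc : List ℕ → List ℕ
sortDesc []       = []
sortDesc (x ∷ xs) = insertDesc x (sortDesc xs)

dropZeros : List ℕ → List ℕ
dropZeros (zero ∷ xs) = dropZeros xs
dropZeros xs          = xs

stripTrailingZeros : List ℕ → List ℕ
stripTrailingZeros xs = reverse (dropZeros (reverse xs))

initC : List ℕ → List ℕ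
initC a = take (length a ∸ 1) a

tildeC : List ℕ → List ℕ
tildeC a = stripTrailingZeros (initC a ++ [ lastPart a ∸ 1 ])

decAt : ℕ → List ℕ → List ℕ
decAt _             []       = []
decAt zero          xs       = xs
decAt (suc zero)    (x ∷ xs) = (x ∸ 1) ∷ xs
decAt (suc (suc i)) (x ∷ xs) = x ∷ decAt (suc i) xs

minusAt : List ℕ → ℕ → List ℕ
minusAt μ i = stripTrailingZeros (decAt i μ)

-- s(ν,b) = max{ i : 1 ≤ i ≤ m, ν_i ≥ b_{h(b)} }   (0 if the set is empty)
sIdxGo : ℕ → ℕ → List ℕ → ℕ
sIdxGo c k []       = 0
sIdxGo c k (x ∷ xs) = (if c ≤ᵇ x then k else 0) ⊔ sIdxGo c (suc k) xs

sIdx : List ℕ → List ℕ → ℕ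
sIdx ν b = sIdxGo (lastPart b) 1 ν

rho : List ℕ → List ℕ → List ℕ
rho ν b = stripTrailingZeros
  (take (s ∸ 1) ν ++ [ at ν s ∸ (lastPart b ∸ at ν (suc s)) ] ++ drop (suc s) ν)
  where s = sIdx ν b

InR : List ℕ → List ℕ → ℕ → Set
InR μ a i = (1 ≤ i) × (i ≤ length μ) × (at μ (suc i) < at μ i)
          × (minusAt μ i ⊵ sortDesc (tildeC a))

_⪯_ : List ℕ → List ℕ → Set
ρ ⪯ μ = (sum ρ ≤ sum μ) × (length ρ ≤ length μ)
      × (∀ i → 1 ≤ i → i ≤ length ρ → at ρ i ≤ at μ i)

TotallyDisconnected : List ℕ → List ℕ → Set
TotallyDisconnected μ ρ = ∀ i → 1 ≤ i → i ≤ length ρ → at μ (suc i) ≤ at ρ i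

InB : ℕ → List ℕ → List ℕ → List ℕ → Set
InB n μ a ρ = IsPartition (n ∸ lastPart a) ρ × (ρ ⊵ sortDesc (initC a))
            × (ρ ⪯ μ) × TotallyDisconnected μ ρ

-- Write ν = μ⁽ⁱ⁾ and ã = (a₁,…,a_{h−1},c) with c = a_h − 1 ≥ 1; for s = s(ν,ã) we have
-- ν_{s+1} < c ≤ ν_s, and ρ = ρ(ν,ã) is ν with the adjacent entries ν_s, ν_{s+1} merged into
-- the single entry x = ν_s + ν_{s+1} − c, where ν_{s+1} ≤ x ≤ ν_s.  So ρ interlaces ν
-- (ν_{k+1} ≤ ρ_k ≤ ν_k), which makes ρ a partition with ρ ≤ ν ≤ μ entrywise; since i ≤ s,
-- μ and ν agree beyond s, and μ_{i+1} ≤ μ_i − 1 = ν_i, which gives total disconnectedness.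
-- The prefix sums of ρ are those of ν before s and those of ν, one step ahead, minus c from s on;
-- as λ(ã) is λ(a') with c inserted, ν ⊵ λ(ã) turns into ρ ⊵ λ(a'), and |ρ| = |ν| − c = n − a_h.

module Submission where

open import Defs
open import Data.Nat using (ℕ; zero; suc; _+_; _∸_; _≤_; _<_; _≤ᵇ_; z≤n; s≤s; _≤?_; _≟_)
open import Data.Nat.Properties
open import Algebra.Properties.CommutativeSemigroup +-commutativeSemigroup using (x∙yz≈y∙xz; xy∙z≈xz∙y)
open import Data.Bool using (true; false; if_then_else_)
open import Data.List using (List; []; _∷_; _++_; [_]; length; take; drop; reverse; replicate)
open import Data.List.Properties using (take-all; reverse-++; reverse-involutive; unfold-reverse)
open import Data.Nat.ListAction using (sum)
open import Data.Nat.ListAction.Properties using (sum-++)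
open import Data.List.Relation.Unary.All as All using (All; []; _∷_)
open import Data.Product using (_×_; _,_; proj₁; proj₂; ∃-syntax)
open import Data.Sum using (_⊎_; inj₁; inj₂)
open import Relation.Binary using (tri<; tri≈; tri>)
open import Relation.Nullary using (yes; no; contradiction)
open import Relation.Nullary.Reflects using (ofʸ; ofⁿ)
open import Relation.Binary.PropositionalEquality hiding ([_])

-- Prefix sums

prefixSum : (ℕ → ℕ) → ℕ → ℕ
prefixSum f zero    = 0
prefixSum f (suc j) = prefixSum f j + f (suc j)

prefixSum-[] : ∀ j → prefixSum (at []) j ≡ 0
prefixSum-[] zero    = refl
prefixSum-[] (suc j) = cong (_+ 0) (prefixSum-[] j)

prefixSum-∷ : ∀ x xs j → prefixSum (at (x ∷ xs)) (suc j) ≡ x + prefixSum (at xs) j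
prefixSum-∷ x xs zero    = +-comm 0 x
prefixSum-∷ x xs (suc j) = trans (cong (_+ at xs (suc j)) (prefixSum-∷ x xs j)) (+-assoc x _ _)

sum-take : ∀ L j → sum (take j L) ≡ prefixSum (at L) j
sum-take []       zero    = refl
sum-take []       (suc j) = sym (prefixSum-[] (suc j))
sum-take (x ∷ xs) zero    = refl
sum-take (x ∷ xs) (suc j) = trans (cong (x +_) (sum-take xs j)) (sym (prefixSum-∷ x xs j))

sum-take-≤ : ∀ L j → sum (take j L) ≤ sum L
sum-take-≤ []       zero    = z≤n
sum-take-≤ []       (suc j) = z≤n
sum-take-≤ (x ∷ xs) zero    = z≤n
sum-take-≤ (x ∷ xs) (suc j) = +-monoʳ-≤ x (sum-take-≤ xs j)

prefixSum-complete : ∀ L {j} → length L ≤ j → prefixSum (at L) j ≡ sum L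
prefixSum-complete L {j} len≤j = trans (sym (sum-take L j)) (cong sum (take-all j L len≤j))

prefixSum-mono : ∀ f {j k} → j ≤ k → prefixSum f j ≤ prefixSum f k
prefixSum-mono f {k = zero}  z≤n   = ≤-refl
prefixSum-mono f {k = suc k} j≤1+k with m≤n⇒m<n∨m≡n j≤1+k
... | inj₂ refl       = ≤-refl
... | inj₁ (s≤s j≤k) = ≤-trans (prefixSum-mono f j≤k) (m≤m+n _ _)

prefixSum-cong : ∀ {f g} j → (∀ k → k ≤ j → f k ≡ g k) → prefixSum f j ≡ prefixSum g j
prefixSum-cong zero    eq = refl
prefixSum-cong (suc j) eq =
  cong₂ _+_ (prefixSum-cong j (λ k k≤j → eq k (m≤n⇒m≤1+n k≤j))) (eq (suc j) ≤-refl)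

at-beyond : ∀ L {j} → length L < j → at L j ≡ 0
at-beyond []           _                      = refl
at-beyond (x ∷ xs)     {zero}        ()
at-beyond (x ∷ [])     {suc zero}    (s≤s ())
at-beyond (x ∷ [])     {suc (suc j)} _           = refl
at-beyond (x ∷ y ∷ xs) {suc zero}    (s≤s ())
at-beyond (x ∷ y ∷ xs) {suc (suc j)} (s≤s len<j) = at-beyond (y ∷ xs) len<j

at-replicate-0 : ∀ z j → at (replicate z 0) j ≡ 0
at-replicate-0 zero    j             = refl
at-replicate-0 (suc z) zero          = refl
at-replicate-0 (suc z) (suc zero)    = refl
at-replicate-0 (suc z) (suc (suc j)) = at-replicate-0 z (suc j)

at-++-replicate-0 : ∀ xs z j → at (xs ++ replicate z 0) j ≡ at xs j
at-++-replicate-0 []       z j             = at-replicate-0 z j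
at-++-replicate-0 (x ∷ xs) z zero          = refl
at-++-replicate-0 (x ∷ xs) z (suc zero)    = refl
at-++-replicate-0 (x ∷ xs) z (suc (suc j)) = at-++-replicate-0 xs z (suc j)

sum-replicate-0 : ∀ z → sum (replicate z 0) ≡ 0
sum-replicate-0 zero    = refl
sum-replicate-0 (suc z) = sum-replicate-0 z

reverse-replicate : ∀ z (x : ℕ) → reverse (replicate z x) ≡ replicate z x
reverse-replicate zero    x = refl
reverse-replicate (suc z) x = begin
  reverse (x ∷ replicate z x)      ≡⟨ unfold-reverse x (replicate z x) ⟩
  reverse (replicate z x) ++ [ x ] ≡⟨ cong (_++ [ x ]) (reverse-replicate z x) ⟩
  replicate z x ++ [ x ]           ≡⟨ replicate-∷ʳ z ⟩
  x ∷ replicate z x                ∎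
  where
  open ≡-Reasoning
  replicate-∷ʳ : ∀ z → replicate z x ++ [ x ] ≡ x ∷ replicate z x
  replicate-∷ʳ zero    = refl
  replicate-∷ʳ (suc z) = cong (x ∷_) (replicate-∷ʳ z)

dropZeros-replicate : ∀ R → ∃[ z ] R ≡ replicate z 0 ++ dropZeros R
dropZeros-replicate []          = 0 , refl
dropZeros-replicate (zero ∷ R)  = let z , eq = dropZeros-replicate R in suc z , cong (0 ∷_) eq
dropZeros-replicate (suc x ∷ R) = 0 , refl

stripTrailingZeros-replicate : ∀ L → ∃[ z ] L ≡ stripTrailingZeros L ++ replicate z 0
stripTrailingZeros-replicate L = z , (begin
  L                                                 ≡⟨ reverse-involutive L ⟨
  reverse (reverse L)                               ≡⟨ cong reverse eq ⟩
  reverse (replicate z 0 ++ dropZeros (reverse L))  ≡⟨ reverse-++ (replicate z 0) _ ⟩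
  stripTrailingZeros L ++ reverse (replicate z 0)   ≡⟨ cong (stripTrailingZeros L ++_) (reverse-replicate z 0) ⟩
  stripTrailingZeros L ++ replicate z 0             ∎)
  where
  open ≡-Reasoning
  z  = proj₁ (dropZeros-replicate (reverse L))
  eq = proj₂ (dropZeros-replicate (reverse L))

at-stripTrailingZeros : ∀ L j → at (stripTrailingZeros L) j ≡ at L j
at-stripTrailingZeros L j =
  let z , eq = stripTrailingZeros-replicate L
  in sym (trans (cong (λ M → at M j) eq) (at-++-replicate-0 (stripTrailingZeros L) z j))

sum-stripTrailingZeros : ∀ L → sum (stripTrailingZeros L) ≡ sum L
sum-stripTrailingZeros L = sym (begin
  sum L                                                   ≡⟨ cong sum eq ⟩
  sum (stripTrailingZeros L ++ replicate z 0)             ≡⟨ sum-++ (stripTrailingZeros L) _ ⟩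
  sum (stripTrailingZeros L) + sum (replicate z 0)        ≡⟨ cong (sum (stripTrailingZeros L) +_) (sum-replicate-0 z) ⟩
  sum (stripTrailingZeros L) + 0                          ≡⟨ +-identityʳ _ ⟩
  sum (stripTrailingZeros L)                              ∎)
  where
  open ≡-Reasoning
  z  = proj₁ (stripTrailingZeros-replicate L)
  eq = proj₂ (stripTrailingZeros-replicate L)

lastPart-∷ʳ : ∀ xs c → lastPart (xs ++ [ c ]) ≡ c
lastPart-∷ʳ []           c = refl
lastPart-∷ʳ (x ∷ [])     c = refl
lastPart-∷ʳ (x ∷ y ∷ xs) c = lastPart-∷ʳ (y ∷ xs) c

stripTrailingZeros-lastPart : ∀ L → stripTrailingZeros L ≡ [] ⊎ 1 ≤ lastPart (stripTrailingZeros L)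
stripTrailingZeros-lastPart L = go (reverse L)
  where
  go : ∀ R → reverse (dropZeros R) ≡ [] ⊎ 1 ≤ lastPart (reverse (dropZeros R))
  go []          = inj₁ refl
  go (zero ∷ R)  = go R
  go (suc x ∷ R) = inj₂ (subst (λ M → 1 ≤ lastPart M) (sym (unfold-reverse (suc x) R))
    (subst (1 ≤_) (sym (lastPart-∷ʳ (reverse R) (suc x))) (s≤s z≤n)))

stripTrailingZeros-∷ʳ : ∀ xs {c} → 1 ≤ c → stripTrailingZeros (xs ++ [ c ]) ≡ xs ++ [ c ]
stripTrailingZeros-∷ʳ xs {suc c} _ = begin
  reverse (dropZeros (reverse (xs ++ [ suc c ]))) ≡⟨ cong (λ M → reverse (dropZeros M)) (reverse-++ xs [ suc c ]) ⟩
  reverse (suc c ∷ reverse xs)                     ≡⟨ unfold-reverse (suc c) (reverse xs) ⟩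
  reverse (reverse xs) ++ [ suc c ]                ≡⟨ cong (_++ [ suc c ]) (reverse-involutive xs) ⟩
  xs ++ [ suc c ]                                  ∎
  where open ≡-Reasoning

initC-∷ʳ-lastPart : ∀ a → 1 ≤ lastPart a → a ≡ initC a ++ [ lastPart a ]
initC-∷ʳ-lastPart []           ()
initC-∷ʳ-lastPart (x ∷ [])     _ = refl
initC-∷ʳ-lastPart (x ∷ y ∷ ys) p = cong (x ∷_) (initC-∷ʳ-lastPart (y ∷ ys) p)

tildeC-∷ʳ : ∀ a → 2 ≤ lastPart a → tildeC a ≡ initC a ++ [ lastPart a ∸ 1 ]
tildeC-∷ʳ a 2≤last = stripTrailingZeros-∷ʳ (initC a) (∸-monoˡ-≤ 1 2≤last)

insertDesc-≤ : ∀ {x y} ys → y ≤ x → insertDesc x (y ∷ ys) ≡ x ∷ y ∷ ys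
insertDesc-≤ {x} {y} ys y≤x with y ≤ᵇ x | ≤ᵇ-reflects-≤ y x
... | true  | _        = refl
... | false | ofⁿ y≰x = contradiction y≤x y≰x

insertDesc-> : ∀ {x y} ys → x < y → insertDesc x (y ∷ ys) ≡ y ∷ insertDesc x ys
insertDesc-> {x} {y} ys x<y with y ≤ᵇ x | ≤ᵇ-reflects-≤ y x
... | true  | ofʸ y≤x = contradiction y≤x (<⇒≱ x<y)
... | false | _        = refl

insertDesc-comm-< : ∀ {x y} L → y < x → insertDesc x (insertDesc y L) ≡ insertDesc y (insertDesc x L)
insertDesc-comm-< {x} {y} [] y<x = trans (insertDesc-≤ [] (<⇒≤ y<x)) (sym (insertDesc-> [] y<x))
insertDesc-comm-< {x} {y} (z ∷ zs) y<x with z ≤? y | z ≤? x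
... | yes z≤y | _ = begin
  insertDesc x (insertDesc y (z ∷ zs)) ≡⟨ cong (insertDesc x) (insertDesc-≤ zs z≤y) ⟩
  insertDesc x (y ∷ z ∷ zs)            ≡⟨ insertDesc-≤ (z ∷ zs) (<⇒≤ y<x) ⟩
  x ∷ y ∷ z ∷ zs                       ≡⟨ cong (x ∷_) (insertDesc-≤ zs z≤y) ⟨
  x ∷ insertDesc y (z ∷ zs)            ≡⟨ insertDesc-> (z ∷ zs) y<x ⟨
  insertDesc y (x ∷ z ∷ zs)            ≡⟨ cong (insertDesc y) (insertDesc-≤ zs (≤-trans z≤y (<⇒≤ y<x))) ⟨
  insertDesc y (insertDesc x (z ∷ zs)) ∎
  where open ≡-Reasoning
... | no z≰y | yes z≤x = begin
  insertDesc x (insertDesc y (z ∷ zs)) ≡⟨ cong (insertDesc x) (insertDesc-> zs (≰⇒> z≰y)) ⟩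
  insertDesc x (z ∷ insertDesc y zs)   ≡⟨ insertDesc-≤ (insertDesc y zs) z≤x ⟩
  x ∷ z ∷ insertDesc y zs              ≡⟨ cong (x ∷_) (insertDesc-> zs (≰⇒> z≰y)) ⟨
  x ∷ insertDesc y (z ∷ zs)            ≡⟨ insertDesc-> (z ∷ zs) y<x ⟨
  insertDesc y (x ∷ z ∷ zs)            ≡⟨ cong (insertDesc y) (insertDesc-≤ zs z≤x) ⟨
  insertDesc y (insertDesc x (z ∷ zs)) ∎
  where open ≡-Reasoning
... | no z≰y | no z≰x = begin
  insertDesc x (insertDesc y (z ∷ zs)) ≡⟨ cong (insertDesc x) (insertDesc-> zs (≰⇒> z≰y)) ⟩
  insertDesc x (z ∷ insertDesc y zs)   ≡⟨ insertDesc-> (insertDesc y zs) (≰⇒> z≰x) ⟩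
  z ∷ insertDesc x (insertDesc y zs)   ≡⟨ cong (z ∷_) (insertDesc-comm-< zs y<x) ⟩
  z ∷ insertDesc y (insertDesc x zs)   ≡⟨ insertDesc-> (insertDesc x zs) (≰⇒> z≰y) ⟨
  insertDesc y (z ∷ insertDesc x zs)   ≡⟨ cong (insertDesc y) (insertDesc-> zs (≰⇒> z≰x)) ⟨
  insertDesc y (insertDesc x (z ∷ zs)) ∎
  where open ≡-Reasoning

insertDesc-comm : ∀ x y L → insertDesc x (insertDesc y L) ≡ insertDesc y (insertDesc x L)
insertDesc-comm x y L with <-cmp y x
... | tri< y<x _ _ = insertDesc-comm-< L y<x
... | tri≈ _ refl _ = refl
... | tri> _ _ x<y = sym (insertDesc-comm-< L x<y)

sortDesc-∷ʳ : ∀ xs c → sortDesc (xs ++ [ c ]) ≡ insertDesc c (sortDesc xs)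
sortDesc-∷ʳ []       c = refl
sortDesc-∷ʳ (x ∷ xs) c = trans (cong (insertDesc x) (sortDesc-∷ʳ xs c)) (insertDesc-comm x c (sortDesc xs))

sum-insertDesc : ∀ c L → sum (insertDesc c L) ≡ c + sum L
sum-insertDesc c []       = refl
sum-insertDesc c (y ∷ ys) with y ≤ᵇ c
... | true  = refl
... | false = trans (cong (y +_) (sum-insertDesc c ys)) (x∙yz≈y∙xz y c (sum ys))

sum-sortDesc : ∀ L → sum (sortDesc L) ≡ sum L
sum-sortDesc []       = refl
sum-sortDesc (x ∷ xs) = trans (sum-insertDesc x (sortDesc xs)) (cong (x +_) (sum-sortDesc xs))

nonIncreasing-tail : ∀ {x xs} → NonIncreasing (x ∷ xs) → NonIncreasing xs
nonIncreasing-tail ni-[x]       = ni-[]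
nonIncreasing-tail (ni-∷ _ ni) = ni

nonIncreasing-head : ∀ {x xs} → NonIncreasing (x ∷ xs) → All (_≤ x) xs
nonIncreasing-head ni-[x]          = []
nonIncreasing-head (ni-∷ y≤x ni) = y≤x ∷ All.map (λ z≤y → ≤-trans z≤y y≤x) (nonIncreasing-head ni)

∷-nonIncreasing : ∀ {x xs} → All (_≤ x) xs → NonIncreasing xs → NonIncreasing (x ∷ xs)
∷-nonIncreasing []          _  = ni-[x]
∷-nonIncreasing (y≤x ∷ _) ni = ni-∷ y≤x ni

insertDesc-All : ∀ {b} c L → c ≤ b → All (_≤ b) L → All (_≤ b) (insertDesc c L)
insertDesc-All c []       c≤b []          = c≤b ∷ []
insertDesc-All c (y ∷ ys) c≤b (y≤b ∷ ys≤b) with y ≤ᵇ c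
... | true  = c≤b ∷ y≤b ∷ ys≤b
... | false = y≤b ∷ insertDesc-All c ys c≤b ys≤b

insertDesc-nonIncreasing : ∀ c {L} → NonIncreasing L → NonIncreasing (insertDesc c L)
insertDesc-nonIncreasing c {[]}     _  = ni-[x]
insertDesc-nonIncreasing c {y ∷ ys} ni with y ≤ᵇ c | ≤ᵇ-reflects-≤ y c
... | true  | ofʸ y≤c = ni-∷ y≤c ni
... | false | ofⁿ y≰c = ∷-nonIncreasing
  (insertDesc-All c ys (<⇒≤ (≰⇒> y≰c)) (nonIncreasing-head ni))
  (insertDesc-nonIncreasing c (nonIncreasing-tail ni))

sortDesc-nonIncreasing : ∀ L → NonIncreasing (sortDesc L)
sortDesc-nonIncreasing []       = ni-[]
sortDesc-nonIncreasing (x ∷ xs) = insertDesc-nonIncreasing x (sortDesc-nonIncreasing xs)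

sum-take-suc-≤ : ∀ {c} L j → All (_≤ c) L → sum (take (suc j) L) ≤ c + sum (take j L)
sum-take-suc-≤             []       j       _              = z≤n
sum-take-suc-≤             (y ∷ ys) zero    (y≤c ∷ _)     = +-monoˡ-≤ 0 y≤c
sum-take-suc-≤ {c} (y ∷ ys) (suc j) (_ ∷ ys≤c) =
  ≤-trans (+-monoʳ-≤ y (sum-take-suc-≤ ys j ys≤c)) (≤-reflexive (x∙yz≈y∙xz y c (sum (take j ys))))

sum-take-insertDesc : ∀ c {L} j → NonIncreasing L → sum (take j L) ≤ sum (take j (insertDesc c L))
sum-take-insertDesc c {L}      zero    _  = z≤n
sum-take-insertDesc c {[]}     (suc j) _  = z≤n
sum-take-insertDesc c {y ∷ ys} (suc j) ni with y ≤ᵇ c | ≤ᵇ-reflects-≤ y c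
... | true  | ofʸ y≤c = sum-take-suc-≤ (y ∷ ys) j (y≤c ∷ All.map (λ z≤y → ≤-trans z≤y y≤c) (nonIncreasing-head ni))
... | false | _        = +-monoʳ-≤ y (sum-take-insertDesc c j (nonIncreasing-tail ni))

sum-take-insertDesc-suc : ∀ c L j → sum (take j L) + c ≤ sum (take (suc j) (insertDesc c L))
sum-take-insertDesc-suc c []       zero    = ≤-reflexive (+-comm 0 c)
sum-take-insertDesc-suc c []       (suc j) = ≤-reflexive (+-comm 0 c)
sum-take-insertDesc-suc c (y ∷ ys) j with y ≤ᵇ c | ≤ᵇ-reflects-≤ y c
... | true  | _        = ≤-reflexive (+-comm (sum (take j (y ∷ ys))) c)
sum-take-insertDesc-suc c (y ∷ ys) zero    | false | ofⁿ y≰c = ≤-trans (<⇒≤ (≰⇒> y≰c)) (m≤m+n y 0)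
sum-take-insertDesc-suc c (y ∷ ys) (suc j) | false | _ =
  ≤-trans (≤-reflexive (+-assoc y _ c)) (+-monoʳ-≤ y (sum-take-insertDesc-suc c ys j))

-- Only positions 1, 2, … matter: position 0 of `at` is a junk 0.
Antitone : (ℕ → ℕ) → Set
Antitone f = ∀ j → f (suc (suc j)) ≤ f (suc j)

nonIncreasing⇒antitone : ∀ {L} → NonIncreasing L → Antitone (at L)
nonIncreasing⇒antitone ni-[]             j       = z≤n
nonIncreasing⇒antitone ni-[x]            j       = z≤n
nonIncreasing⇒antitone (ni-∷ y≤x _)    zero    = y≤x
nonIncreasing⇒antitone (ni-∷ _ ni)     (suc j) = nonIncreasing⇒antitone ni j

antitone⇒nonIncreasing : ∀ S → Antitone (at S) → S ≡ [] ⊎ 1 ≤ lastPart S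
  → All (1 ≤_) S × NonIncreasing S
antitone⇒nonIncreasing []           _  _          = [] , ni-[]
antitone⇒nonIncreasing (x ∷ [])     _  (inj₂ 1≤x) = (1≤x ∷ []) , ni-[x]
antitone⇒nonIncreasing (x ∷ y ∷ ys) ↓ (inj₂ 1≤last)
  with antitone⇒nonIncreasing (y ∷ ys) (λ j → ↓ (suc j)) (inj₂ 1≤last)
... | (1≤y ∷ pos) , ni = (≤-trans 1≤y (↓ 0) ∷ 1≤y ∷ pos) , ni-∷ (↓ 0) ni

length-≤-prefixSum : ∀ R q → R ≡ [] ⊎ 1 ≤ lastPart R → sum R ≤ prefixSum (at R) q → length R ≤ q
length-≤-prefixSum R q _ _ with length R ≤? q
... | yes len≤q = len≤q
length-≤-prefixSum []       q _            _ | no len≰q = contradiction z≤n len≰q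
length-≤-prefixSum (r ∷ rs) q (inj₂ 1≤last) sum≤ | no len≰q = contradiction sum≤ (<⇒≱ (begin-strict
  prefixSum (at (r ∷ rs)) q                                  ≤⟨ prefixSum-mono (at (r ∷ rs)) (≤-pred (≰⇒> len≰q)) ⟩
  prefixSum (at (r ∷ rs)) (length rs)                        <⟨ m<m+n _ 1≤last ⟩
  prefixSum (at (r ∷ rs)) (length rs) + lastPart (r ∷ rs)  ≡⟨ prefixSum-complete (r ∷ rs) ≤-refl ⟩
  sum (r ∷ rs)                                               ∎))
  where open ≤-Reasoning

length-≤-at : ∀ R μ → R ≡ [] ⊎ 1 ≤ lastPart R → (∀ k → at R (suc k) ≤ at μ (suc k)) → length R ≤ length μ
length-≤-at R μ _ _ with length R ≤? length μ
... | yes len≤ = len≤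
length-≤-at []       μ _             _ | no len≰ = contradiction z≤n len≰
length-≤-at (r ∷ rs) μ (inj₂ 1≤last) ≤μ | no len≰ = contradiction
  (≤-trans 1≤last (≤-trans (≤μ (length rs)) (≤-reflexive (at-beyond μ (≰⇒> len≰))))) λ ()

-- The index s(ν,b) and the partition μ⁽ⁱ⁾

sIdxGo-maximal : ∀ {c} k L j → 1 ≤ c → c ≤ at L (suc j) → k + j ≤ sIdxGo c k L
sIdxGo-maximal     k []       j       1≤c c≤0 = contradiction (≤-trans 1≤c c≤0) λ ()
sIdxGo-maximal {c} k (x ∷ xs) zero    _   c≤x with c ≤ᵇ x | ≤ᵇ-reflects-≤ c x
... | true  | _        = ≤-trans (≤-reflexive (+-identityʳ k)) (m≤m⊔n k _)
... | false | ofⁿ c≰x = contradiction c≤x c≰x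
sIdxGo-maximal     k (x ∷ xs) (suc j) 1≤c c≤at =
  ≤-trans (≤-reflexive (+-suc k j)) (≤-trans (sIdxGo-maximal (suc k) xs j 1≤c c≤at) (m≤n⊔m _ _))

sIdxGo-witness : ∀ c k L → sIdxGo c k L ≡ 0 ⊎ ∃[ j ] (sIdxGo c k L ≡ k + j × c ≤ at L (suc j))
sIdxGo-witness c k []       = inj₁ refl
sIdxGo-witness c k (x ∷ xs) with ⊔-sel (if c ≤ᵇ x then k else 0) (sIdxGo c (suc k) xs)
... | inj₁ eq with c ≤ᵇ x | ≤ᵇ-reflects-≤ c x
...   | true  | ofʸ c≤x = inj₂ (0 , trans eq (sym (+-identityʳ k)) , c≤x)
...   | false | _        = inj₁ eq
sIdxGo-witness c k (x ∷ xs) | inj₂ eq with sIdxGo-witness c (suc k) xs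
... | inj₁ eq′              = inj₁ (trans eq eq′)
... | inj₂ (j , eq′ , c≤at) = inj₂ (suc j , trans eq (trans eq′ (sym (+-suc k j))) , c≤at)

at-decAt-self : ∀ L i → at (decAt (suc i) L) (suc i) ≡ at L (suc i) ∸ 1
at-decAt-self []       i       = refl
at-decAt-self (x ∷ xs) zero    = refl
at-decAt-self (x ∷ xs) (suc i) = at-decAt-self xs i

at-decAt-other : ∀ L i {j} → j ≢ suc i → at (decAt (suc i) L) j ≡ at L j
at-decAt-other []           i       _ = refl
at-decAt-other (x ∷ xs)     zero    {zero}        _  = refl
at-decAt-other (x ∷ xs)     (suc i) {zero}        _  = refl
at-decAt-other (x ∷ xs)     zero    {suc zero}    j≢ = contradiction refl j≢
at-decAt-other (x ∷ [])     zero    {suc (suc j)} _  = refl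
at-decAt-other (x ∷ y ∷ xs) zero    {suc (suc j)} _  = refl
at-decAt-other (x ∷ xs)     (suc i) {suc zero}    _  = refl
at-decAt-other (x ∷ xs)     (suc i) {suc (suc j)} j≢ = at-decAt-other xs i (λ eq → j≢ (cong suc eq))

sum-decAt : ∀ L i → 1 ≤ at L (suc i) → sum (decAt (suc i) L) + 1 ≡ sum L
sum-decAt []           i       ()
sum-decAt (suc x ∷ xs) zero    _ = +-comm (x + sum xs) 1
sum-decAt (x ∷ xs)     (suc i) p = trans (+-assoc x _ 1) (cong (x +_) (sum-decAt xs i p))

at-minusAt-self : ∀ μ i → at (minusAt μ (suc i)) (suc i) ≡ at μ (suc i) ∸ 1
at-minusAt-self μ i = trans (at-stripTrailingZeros (decAt (suc i) μ) (suc i)) (at-decAt-self μ i)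

at-minusAt-other : ∀ μ i {j} → j ≢ suc i → at (minusAt μ (suc i)) j ≡ at μ j
at-minusAt-other μ i j≢ = trans (at-stripTrailingZeros (decAt (suc i) μ) _) (at-decAt-other μ i j≢)

at-minusAt-≤ : ∀ μ i j → at (minusAt μ (suc i)) j ≤ at μ j
at-minusAt-≤ μ i j with j ≟ suc i
... | yes refl = ≤-trans (≤-reflexive (at-minusAt-self μ i)) (m∸n≤m _ 1)
... | no j≢    = ≤-reflexive (at-minusAt-other μ i j≢)

sum-minusAt : ∀ μ i → 1 ≤ at μ (suc i) → sum (minusAt μ (suc i)) + 1 ≡ sum μ
sum-minusAt μ i p = trans (cong (_+ 1) (sum-stripTrailingZeros (decAt (suc i) μ))) (sum-decAt μ i p)

minusAt-interlaced : ∀ {μ} i → NonIncreasing μ → at μ (suc (suc i)) < at μ (suc i)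
  → ∀ k → at μ (suc (suc k)) ≤ at (minusAt μ (suc i)) (suc k)
minusAt-interlaced {μ} i μ↓ μ-drop k with suc k ≟ suc i
... | yes refl = ≤-trans (<⇒≤pred μ-drop)
  (≤-reflexive (trans (pred[m∸n]≡m∸[1+n] (at μ (suc i)) 0) (sym (at-minusAt-self μ i))))
... | no k≢i   = ≤-trans (nonIncreasing⇒antitone μ↓ k) (≤-reflexive (sym (at-minusAt-other μ i k≢i)))

minusAt-antitone : ∀ {μ} i → NonIncreasing μ → at μ (suc (suc i)) < at μ (suc i)
  → Antitone (at (minusAt μ (suc i)))
minusAt-antitone {μ} i μ↓ μ-drop k =
  ≤-trans (at-minusAt-≤ μ i (suc (suc k))) (minusAt-interlaced i μ↓ μ-drop k)

-- Merging two adjacent entries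

record IsMerge (f g : ℕ → ℕ) (t x : ℕ) : Set where
  field
    before : ∀ k → k ≤ t → g k ≡ f k
    merged : g (suc t) ≡ x
    after  : ∀ k → suc t < k → g k ≡ f (suc k)

mergeList : List ℕ → ℕ → ℕ → List ℕ
mergeList L t x = take t L ++ x ∷ drop (suc (suc t)) L

mergeList-isMerge : ∀ L t x → t < length L → IsMerge (at L) (at (mergeList L t x)) t x
mergeList-isMerge L t x t<len = record
  { before = λ k → before L t k t<len ; merged = merged L t t<len ; after = λ k → after L t k t<len }
  where
  before : ∀ L t k → t < length L → k ≤ t → at (mergeList L t x) k ≡ at L k
  before (y ∷ ys) zero    zero          _           _           = refl
  before (y ∷ ys) (suc t) zero          _           _           = refl
  before (y ∷ ys) (suc t) (suc zero)    _           _           = refl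
  before (y ∷ ys) (suc t) (suc (suc k)) (s≤s t<len) (s≤s k≤t) = before ys t (suc k) t<len k≤t
  merged : ∀ L t → t < length L → at (mergeList L t x) (suc t) ≡ x
  merged (y ∷ ys) zero    _           = refl
  merged (y ∷ ys) (suc t) (s≤s t<len) = merged ys t t<len
  after : ∀ L t k → t < length L → suc t < k → at (mergeList L t x) k ≡ at L (suc k)
  after (y ∷ ys)     zero    (suc zero)    _ (s≤s ())
  after (y ∷ [])     zero    (suc (suc k)) _ _ = refl
  after (y ∷ z ∷ ys) zero    (suc (suc k)) _ _ = refl
  after (y ∷ ys)     (suc t) (suc (suc k)) (s≤s t<len) (s≤s t<k) = after ys t (suc k) t<len t<k

isMerge-resp : ∀ {f g h t x} → (∀ k → g k ≡ h k) → IsMerge f g t x → IsMerge f h t x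
isMerge-resp g≗h m = record
  { before = λ k k≤t → trans (sym (g≗h k)) (before k k≤t)
  ; merged = trans (sym (g≗h _)) merged
  ; after  = λ k t<k → trans (sym (g≗h k)) (after k t<k) }
  where open IsMerge m

module _ {f g t x} (m : IsMerge f g t x) (f↓ : Antitone f) where
  open IsMerge m

  merge-≤ : x ≤ f (suc t) → ∀ k → g (suc k) ≤ f (suc k)
  merge-≤ x≤ k with <-cmp (suc k) (suc t)
  ... | tri< k<t _ _  = ≤-reflexive (before (suc k) (≤-pred k<t))
  ... | tri≈ _ refl _ = ≤-trans (≤-reflexive merged) x≤
  ... | tri> _ _ t<k  = ≤-trans (≤-reflexive (after (suc k) t<k)) (f↓ k)

  merge-≥ : f (suc (suc t)) ≤ x → ∀ k → f (suc (suc k)) ≤ g (suc k)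
  merge-≥ ≤x k with <-cmp (suc k) (suc t)
  ... | tri< k<t _ _  = ≤-trans (f↓ k) (≤-reflexive (sym (before (suc k) (≤-pred k<t))))
  ... | tri≈ _ refl _ = ≤-trans ≤x (≤-reflexive (sym merged))
  ... | tri> _ _ t<k  = ≤-reflexive (sym (after (suc k) t<k))

  merge-antitone : f (suc (suc t)) ≤ x → x ≤ f (suc t) → Antitone g
  merge-antitone ≤x x≤ k = ≤-trans (merge-≤ x≤ (suc k)) (merge-≥ ≤x k)

module _ {f g t x} (m : IsMerge f g t x) where
  open IsMerge m

  merge-prefixSum-before : ∀ j → j ≤ t → prefixSum g j ≡ prefixSum f j
  merge-prefixSum-before j j≤t = prefixSum-cong j (λ k k≤j → before k (≤-trans k≤j j≤t))

  merge-prefixSum-after : ∀ {c} → x + c ≡ f (suc t) + f (suc (suc t))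
    → ∀ j → t < j → prefixSum g j + c ≡ prefixSum f (suc j)
  merge-prefixSum-after {c} x+c (suc j′) (s≤s t≤j′) with m≤n⇒m<n∨m≡n t≤j′
  ... | inj₂ refl = begin
    (prefixSum g t + g (suc t)) + c ≡⟨ cong₂ (λ u v → (u + v) + c) (merge-prefixSum-before t ≤-refl) merged ⟩
    (prefixSum f t + x) + c         ≡⟨ +-assoc (prefixSum f t) x c ⟩
    prefixSum f t + (x + c)         ≡⟨ cong (prefixSum f t +_) x+c ⟩
    prefixSum f t + (f (suc t) + f (suc (suc t)))
                                    ≡⟨ +-assoc (prefixSum f t) _ _ ⟨
    prefixSum f (suc (suc t))       ∎
    where open ≡-Reasoning
  ... | inj₁ t<j′ = begin
    (prefixSum g j′ + g (suc j′)) + c ≡⟨ xy∙z≈xz∙y (prefixSum g j′) _ c ⟩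
    (prefixSum g j′ + c) + g (suc j′) ≡⟨ cong₂ _+_ (merge-prefixSum-after x+c j′ t<j′) (after (suc j′) (s≤s t<j′)) ⟩
    prefixSum f (suc (suc j′))        ∎
    where open ≡-Reasoning

  merge-dominates : ∀ {Λ c} → NonIncreasing Λ → x + c ≡ f (suc t) + f (suc (suc t))
    → (∀ j → sum (take j (insertDesc c Λ)) ≤ prefixSum f j)
    → ∀ j → sum (take j Λ) ≤ prefixSum g j
  merge-dominates {Λ} {c} Λ↓ x+c ins≤f j with j ≤? t
  ... | yes j≤t = begin
    sum (take j Λ)                ≤⟨ sum-take-insertDesc c j Λ↓ ⟩
    sum (take j (insertDesc c Λ)) ≤⟨ ins≤f j ⟩
    prefixSum f j                 ≡⟨ merge-prefixSum-before j j≤t ⟨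
    prefixSum g j                 ∎
    where open ≤-Reasoning
  ... | no j≰t = +-cancelʳ-≤ c _ _ (begin
    sum (take j Λ) + c                  ≤⟨ sum-take-insertDesc-suc c Λ j ⟩
    sum (take (suc j) (insertDesc c Λ)) ≤⟨ ins≤f (suc j) ⟩
    prefixSum f (suc j)                 ≡⟨ merge-prefixSum-after x+c j (≰⇒> j≰t) ⟨
    prefixSum g j + c                   ∎)
    where open ≤-Reasoning

merge-sum : ∀ {ν R t x c} → IsMerge (at ν) (at R) t x → x + c ≡ at ν (suc t) + at ν (suc (suc t))
  → sum R + c ≡ sum ν
merge-sum {ν} {R} {t} {x} {c} m x+c = begin
  sum R + c                    ≡⟨ cong (_+ c) (prefixSum-complete R (m≤m+n (length R) _)) ⟨
  prefixSum (at R) bound + c   ≡⟨ merge-prefixSum-after m x+c bound (≤-trans (m≤m+n (suc t) _) (m≤n+m _ (length R))) ⟩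
  prefixSum (at ν) (suc bound) ≡⟨ prefixSum-complete ν (≤-trans (m≤n+m _ (suc t)) (≤-trans (m≤n+m _ (length R)) (n≤1+n bound))) ⟩
  sum ν                        ∎
  where
  open ≡-Reasoning
  bound = length R + (suc t + length ν)

⊵⇒prefixSum : ∀ ν β → ν ⊵ β → sum β ≤ sum ν → ∀ j → sum (take j β) ≤ prefixSum (at ν) j
⊵⇒prefixSum ν β _         _   zero    = z≤n
⊵⇒prefixSum ν β (_ , dom) β≤ν (suc j) with suc j ≤? length ν
... | yes j<len = ≤-trans (dom (suc j) (s≤s z≤n) j<len) (≤-reflexive (sum-take ν (suc j)))
... | no j≮len  = begin
  sum (take (suc j) β)     ≤⟨ sum-take-≤ β (suc j) ⟩
  sum β                    ≤⟨ β≤ν ⟩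
  sum ν                    ≡⟨ prefixSum-complete ν (<⇒≤ (≰⇒> j≮len)) ⟨
  prefixSum (at ν) (suc j) ∎
  where open ≤-Reasoning

∸-∸-+ : ∀ {p q c} → q ≤ c → c ≤ p → (p ∸ (c ∸ q)) + c ≡ p + q
∸-∸-+ {p} {q} {c} q≤c c≤p = begin
  (p ∸ (c ∸ q)) + c             ≡⟨ cong ((p ∸ (c ∸ q)) +_) (m∸n+n≡m q≤c) ⟨
  (p ∸ (c ∸ q)) + ((c ∸ q) + q) ≡⟨ +-assoc _ (c ∸ q) q ⟨
  ((p ∸ (c ∸ q)) + (c ∸ q)) + q ≡⟨ cong (_+ q) (m∸n+n≡m (≤-trans (m∸n≤m c q) c≤p)) ⟩
  p + q                         ∎
  where open ≡-Reasoning

≤-∸-∸ : ∀ {p q c} → q ≤ c → c ≤ p → q ≤ p ∸ (c ∸ q)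
≤-∸-∸ {p} {q} {c} q≤c c≤p = +-cancelʳ-≤ c q _ (begin
  q + c             ≤⟨ +-monoʳ-≤ q c≤p ⟩
  q + p             ≡⟨ +-comm q p ⟩
  p + q             ≡⟨ ∸-∸-+ q≤c c≤p ⟨
  p ∸ (c ∸ q) + c   ∎)
  where open ≤-Reasoning

rho-mergeList : ∀ ν b {t} → sIdx ν b ≡ suc t
  → rho ν b ≡ stripTrailingZeros (mergeList ν t (at ν (suc t) ∸ (lastPart b ∸ at ν (suc (suc t)))))
rho-mergeList ν b eq = cong (λ s → stripTrailingZeros
  (take (s ∸ 1) ν ++ [ at ν s ∸ (lastPart b ∸ at ν (suc s)) ] ++ drop (suc s) ν)) eq

module _ {n μ a} (μ-part : IsPartition n μ) (a-comp : IsComposition n a) (2≤aₕ : 2 ≤ lastPart a)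
         {i} (i∈R : InR μ a (suc i)) {t} (i≤t : i ≤ t)
         (s≡1+t : sIdx (minusAt μ (suc i)) (tildeC a) ≡ suc t)
         (c≤νₜ : lastPart (tildeC a) ≤ at (minusAt μ (suc i)) (suc t)) where

  private
    ν  = minusAt μ (suc i)
    a′ = initC a
    aₕ = lastPart a
    c  = lastPart (tildeC a)
    x  = at ν (suc t) ∸ (c ∸ at ν (suc (suc t)))
    ρ  = stripTrailingZeros (mergeList ν t x)
    μ↓ = proj₂ μ-part
    μ-drop = proj₁ (proj₂ (proj₂ i∈R))

    c≡aₕ∸1 : c ≡ aₕ ∸ 1
    c≡aₕ∸1 = trans (cong lastPart (tildeC-∷ʳ a 2≤aₕ)) (lastPart-∷ʳ a′ _)

    c+1≡aₕ : c + 1 ≡ aₕ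
    c+1≡aₕ = trans (cong (_+ 1) c≡aₕ∸1) (m∸n+n≡m (≤-trans (s≤s z≤n) 2≤aₕ))

    1≤c : 1 ≤ c
    1≤c = ≤-trans (∸-monoˡ-≤ 1 2≤aₕ) (≤-reflexive (sym c≡aₕ∸1))

    νₜ₊₁<c : at ν (suc (suc t)) < c
    νₜ₊₁<c = ≰⇒> λ c≤ → 1+n≰n (≤-trans (sIdxGo-maximal 1 ν (suc t) 1≤c c≤) (≤-reflexive s≡1+t))

    t<len : t < length ν
    t<len with suc t ≤? length ν
    ... | yes t<len = t<len
    ... | no t≮len  = contradiction (≤-trans 1≤c (≤-trans c≤νₜ (≤-reflexive (at-beyond ν (≰⇒> t≮len))))) λ ()

    ρ-merge : IsMerge (at ν) (at ρ) t x
    ρ-merge = isMerge-resp (λ k → sym (at-stripTrailingZeros (mergeList ν t x) k)) (mergeList-isMerge ν t x t<len)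

    x+c : x + c ≡ at ν (suc t) + at ν (suc (suc t))
    x+c = ∸-∸-+ (<⇒≤ νₜ₊₁<c) c≤νₜ

    ν↓ : Antitone (at ν)
    ν↓ = minusAt-antitone i μ↓ μ-drop

    sum-a′ : sum a′ + aₕ ≡ n
    sum-a′ = begin
      sum a′ + aₕ          ≡⟨ cong (sum a′ +_) (+-identityʳ aₕ) ⟨
      sum a′ + sum [ aₕ ]  ≡⟨ sum-++ a′ [ aₕ ] ⟨
      sum (a′ ++ [ aₕ ])   ≡⟨ cong sum (initC-∷ʳ-lastPart a (≤-trans (s≤s z≤n) 2≤aₕ)) ⟨
      sum a                ≡⟨ proj₂ a-comp ⟩
      n                    ∎
      where open ≡-Reasoning

    ρ-last : ρ ≡ [] ⊎ 1 ≤ lastPart ρ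
    ρ-last = stripTrailingZeros-lastPart (mergeList ν t x)

    x≤νₜ : x ≤ at ν (suc t)
    x≤νₜ = m∸n≤m (at ν (suc t)) (c ∸ at ν (suc (suc t)))

    νₜ₊₁≤x : at ν (suc (suc t)) ≤ x
    νₜ₊₁≤x = ≤-∸-∸ (<⇒≤ νₜ₊₁<c) c≤νₜ

    ρ≤ν : ∀ k → at ρ (suc k) ≤ at ν (suc k)
    ρ≤ν = merge-≤ ρ-merge ν↓ x≤νₜ

    ρ≥ν : ∀ k → at ν (suc (suc k)) ≤ at ρ (suc k)
    ρ≥ν = merge-≥ ρ-merge ν↓ νₜ₊₁≤x

    sum-ρ : sum ρ ≡ sum a′
    sum-ρ = +-cancelʳ-≡ aₕ _ _ (begin
      sum ρ + aₕ        ≡⟨ cong (sum ρ +_) c+1≡aₕ ⟨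
      sum ρ + (c + 1)   ≡⟨ +-assoc (sum ρ) c 1 ⟨
      (sum ρ + c) + 1   ≡⟨ cong (_+ 1) (merge-sum {ν} {ρ} ρ-merge x+c) ⟩
      sum ν + 1         ≡⟨ sum-minusAt μ i (≤-trans (s≤s z≤n) μ-drop) ⟩
      sum μ             ≡⟨ proj₂ (proj₁ μ-part) ⟩
      n                 ≡⟨ sum-a′ ⟨
      sum a′ + aₕ       ∎)
      where open ≡-Reasoning

    n∸aₕ≡sum-ρ : n ∸ aₕ ≡ sum ρ
    n∸aₕ≡sum-ρ = trans (cong (_∸ aₕ) (sym sum-a′)) (trans (m+n∸n≡m (sum a′) aₕ) (sym sum-ρ))

    ρ-partition : IsPartition (n ∸ aₕ) ρ
    ρ-partition = let pos , ρ↓ = antitone⇒nonIncreasing ρ (merge-antitone ρ-merge ν↓ νₜ₊₁≤x x≤νₜ) ρ-last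
                  in (pos , sym n∸aₕ≡sum-ρ) , ρ↓

    ρ-prefix : ∀ j → sum (take j (sortDesc a′)) ≤ prefixSum (at ρ) j
    ρ-prefix = merge-dominates ρ-merge (sortDesc-nonIncreasing a′) x+c
      (⊵⇒prefixSum ν _ (subst (ν ⊵_) sortDesc-tildeC (proj₂ (proj₂ (proj₂ i∈R)))) (begin
        sum (insertDesc c (sortDesc a′)) ≡⟨ sum-insertDesc c (sortDesc a′) ⟩
        c + sum (sortDesc a′)            ≡⟨ cong (c +_) (trans (sum-sortDesc a′) (sym sum-ρ)) ⟩
        c + sum ρ                        ≡⟨ +-comm c (sum ρ) ⟩
        sum ρ + c                        ≡⟨ merge-sum {ν} {ρ} ρ-merge x+c ⟩
        sum ν                            ∎))
      where
      open ≤-Reasoning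
      sortDesc-tildeC : sortDesc (tildeC a) ≡ insertDesc c (sortDesc a′)
      sortDesc-tildeC = trans (cong sortDesc (trans (tildeC-∷ʳ a 2≤aₕ) (cong (λ z → a′ ++ [ z ]) (sym c≡aₕ∸1))))
                              (sortDesc-∷ʳ a′ c)

    ρ-dominates : ρ ⊵ sortDesc a′
    ρ-dominates = length-≤-prefixSum ρ _ ρ-last (begin
        sum ρ                        ≡⟨ trans sum-ρ (sym (sum-sortDesc a′)) ⟩
        sum (sortDesc a′)            ≡⟨ cong sum (take-all ℓ (sortDesc a′) ≤-refl) ⟨
        sum (take ℓ (sortDesc a′))   ≤⟨ ρ-prefix ℓ ⟩
        prefixSum (at ρ) ℓ           ∎)
      , λ j _ _ → ≤-trans (ρ-prefix j) (≤-reflexive (sym (sum-take ρ j)))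
      where
      open ≤-Reasoning
      ℓ = length (sortDesc a′)

    ρ≤μ : ∀ k → at ρ (suc k) ≤ at μ (suc k)
    ρ≤μ k = ≤-trans (ρ≤ν k) (at-minusAt-≤ μ i (suc k))

    ρ⪯μ : ρ ⪯ μ
    ρ⪯μ = ≤-trans (≤-reflexive (sym n∸aₕ≡sum-ρ)) (≤-trans (m∸n≤m n aₕ) (≤-reflexive (sym (proj₂ (proj₁ μ-part)))))
        , length-≤-at ρ μ ρ-last ρ≤μ
        , λ { (suc k) _ _ → ρ≤μ k }

    μ/ρ-disconnected : TotallyDisconnected μ ρ
    μ/ρ-disconnected (suc k) _ _ with suc k ≤? t
    ... | yes k<t = ≤-trans (minusAt-interlaced i μ↓ μ-drop k) (≤-reflexive (sym (IsMerge.before ρ-merge (suc k) k<t)))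
    ... | no k≮t  = ≤-trans (≤-reflexive (sym (at-minusAt-other μ i 2+k≢1+i))) (ρ≥ν k)
      where
      2+k≢1+i : suc (suc k) ≢ suc i
      2+k≢1+i eq = k≮t (≤-trans (≤-reflexive (suc-injective eq)) i≤t)

  merged-∈B : InB n μ a ρ
  merged-∈B = ρ-partition , ρ-dominates , ρ⪯μ , μ/ρ-disconnected

lemma4p1 : (n : ℕ) (μ a : List ℕ) → IsPartition n μ → IsComposition n a
    → μ ⊵ sortDesc a → 2 ≤ lastPart a
    → (i : ℕ) → InR μ a i → i ≤ sIdx (minusAt μ i) (tildeC a)
    → InB n μ a (rho (minusAt μ i) (tildeC a))
lemma4p1 n μ a μ-part a-comp _ 2≤aₕ zero    (() , _) _
lemma4p1 n μ a μ-part a-comp _ 2≤aₕ (suc i) i∈R      i≤s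
  with sIdxGo-witness (lastPart (tildeC a)) 1 (minusAt μ (suc i))
... | inj₁ s≡0 = contradiction (≤-trans i≤s (≤-reflexive s≡0)) λ ()
... | inj₂ (t , s≡1+t , c≤νₜ) = subst (InB n μ a) (sym (rho-mergeList (minusAt μ (suc i)) (tildeC a) s≡1+t))
  (merged-∈B μ-part a-comp 2≤aₕ i∈R (≤-pred (≤-trans i≤s (≤-reflexive s≡1+t))) s≡1+t c≤νₜ)
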